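{- Let $G=(X,Y,E)$ be a complete bipartite graph and let $\sigma$ be an imbalance optimal ordering of $X\cup Y$. Let $y_1,\dots,y_{|Y|}$ be the vertices of $Y$ listed in the order in which they occur in $\sigma$ (so $y_i$ is at position $l_i$, $l_1<\dots<l_{|Y|}$), and let $\sigma'=\mathrm{shift}_L(\sigma)$ be the ordering obtained from $\sigma$ by moving the vertex $y_{\lfloor |Y|/2\rfloor}$ to the leftmost position while keeping the relative order of all other vertices unchanged. Then $I(\sigma,G)=I(\sigma',G)$.
   Context: All graphs are finite, simple, undirected and connected. An ordering of a finite set $V$ is a bijection $\sigma:V\to\{1,\dots,|V|\}$; $u<_\sigma v$ means $\sigma(u)<\sigma(v)$. For a graph $G=(V,E)$, $I(v,\sigma,G)=\big|\,|\{u\in N(v): u<_\sigma v\}|-|\{u\in N(v): u>_\sigma v\}|\,\big|$ and $I(\sigma,G)=\sum_{v\in V}I(v,\sigma,G)$. The imbalance of $G$ is $I(G)=\min_\sigma I(\sigma,G)$ over all orderings $\sigma$ of $V$; an ordering $\sigma$ is imbalance optimal if $I(\sigma,G)=I(G)$. In terms of blocks: writing $\sigma=\sigma_{L_0}\sigma_{\{y_1\}}\sigma_{L_1}\cdots\sigma_{\{y_{|Y|}\}}\sigma_{L_{|Y|}}$ where $L_i$ is the set of vertices of $X$ strictly between $y_i$ and $y_{i+1}$ (with $L_0$ the vertices of $X$ before $y_1$ and $L_{|Y|}$ those after $y_{|Y|}$), $\mathrm{shift}_L(\sigma)=\sigma_{\{y_{\lfloor |Y|/2\rfloor}\}}\sigma_{L_0}\big(\prod_{i=1}^{\lfloor|Y|/2\rfloor-1}\sigma_{\{y_i\}}\sigma_{L_i}\big)\sigma_{L_{\lfloor|Y|/2\rfloor}}\big(\prod_{i=\lfloor|Y|/2\rfloor+1}^{|Y|}\sigma_{\{y_i\}}\sigma_{L_i}\big)$,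 where juxtaposition denotes concatenation of orderings. -}

module Defs where

open import Data.Nat.Base using (ℕ; zero; suc; _<_; _≤_; _<ᵇ_; _≤ᵇ_; ∣_-_∣; ⌊_/2⌋)
open import Data.Fin.Base using (Fin; toℕ)
open import Data.Fin.Permutation using (Permutation′; _⟨$⟩ʳ_)
open import Data.Bool.Base using (Bool; true; false; _∧_; _xor_; if_then_else_)
open import Data.List.Base using (List; []; _∷_; allFin; map)
open import Data.Nat.ListAction using (sum)
open import Data.Product.Base using (_×_)
open import Relation.Nullary using (¬_)
open import Relation.Binary.PropositionalEquality using (_≡_)

record SimpleGraph (n : ℕ) : Set where
  field
    Adj    : Fin n → Fin n → Bool
    Adj-sym    : ∀ u v → Adj u v ≡ Adj v u
    Adj-irrefl : ∀ v → Adj v v ≡ false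
open SimpleGraph public

-- An ordering of V = Fin n is a bijection V → {0,…,n-1} (0-indexed positions).
Ordering : ℕ → Set
Ordering n = Permutation′ n

pos : ∀ {n} → Ordering n → Fin n → ℕ
pos σ v = toℕ (σ ⟨$⟩ʳ v)

countL : ∀ {A : Set} → (A → Bool) → List A → ℕ
countL p []       = zero
countL p (x ∷ xs) = if p x then suc (countL p xs) else countL p xs

count : ∀ {n} → (Fin n → Bool) → ℕ
count {n} p = countL p (allFin n)

Iv : ∀ {n} → SimpleGraph n → Ordering n → Fin n → ℕ
Iv G σ v = ∣ count (λ u → Adj G u v ∧ (pos σ u <ᵇ pos σ v))
           - count (λ u → Adj G u v ∧ (pos σ v <ᵇ pos σ u)) ∣

Iσ : ∀ {n} → SimpleGraph n → Ordering n → ℕ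
Iσ {n} G σ = sum (map (Iv G σ) (allFin n))

ImbalanceOptimal : ∀ {n} → SimpleGraph n → Ordering n → Set
ImbalanceOptimal {n} G σ = ∀ (τ : Ordering n) → Iσ G σ ≤ Iσ G τ

IsCompleteBipartite : ∀ {n} → SimpleGraph n → (Fin n → Bool) → Set
IsCompleteBipartite G inY = ∀ u v → Adj G u v ≡ (inY u xor inY v)

-- rank (1-indexed) of w among the Y-vertices in the order σ
rankY : ∀ {n} → (Fin n → Bool) → Ordering n → Fin n → ℕ
rankY inY σ w = count (λ u → inY u ∧ (pos σ u ≤ᵇ pos σ w))

IsShiftL : ∀ {n} → (Fin n → Bool) → Ordering n → Ordering n → Fin n → Set
IsShiftL inY σ σ' w =
  (inY w ≡ true) × ((rankY inY σ w ≡ ⌊ count inY /2⌋) × ((pos σ' w ≡ 0) ×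
    (∀ u v → ¬ (u ≡ w) → ¬ (v ≡ w) → pos σ u < pos σ v → pos σ' u < pos σ' v)))

-- Moving w to the front changes only the imbalances of w and of the vertices it jumps
-- over.  If w has a neighbours to its left and b to its right, I(w) grows from |a - b|
-- to a + b, i.e. by at most 2a.  Each of the a jumped neighbours x lies in X and sees
-- all of Y; fewer than ⌊|Y|/2⌋ vertices of Y precede x (they all precede w, whose rank
-- in Y is ⌊|Y|/2⌋), so x has at least two more neighbours to its right than to its
-- left, and w crossing over makes I(x) drop by exactly 2.  Hence I(σ') ≤ I(σ), and
-- optimality of σ gives equality.
module Submission where

open import Defs
open import Data.Bool.Base using (Bool; true; false; _∧_; _xor_; not; T)
open import Data.Bool.Properties using (∧-zeroʳ)
open import Data.Empty using (⊥-elim)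
open import Data.Fin.Base using (Fin; zero; suc)
open import Data.Fin.Properties using (toℕ-injective; _≟_)
open import Data.Fin.Permutation using (_⟨$⟩ˡ_; inverseˡ)
open import Data.List.Base using (List; []; _∷_; allFin; map; tabulate)
open import Data.List.Properties using (map-cong; map-tabulate)
open import Data.Nat.Base
  using (ℕ; zero; suc; _+_; _*_; _<_; _≤_; _<ᵇ_; _≤ᵇ_; ∣_-_∣; ⌊_/2⌋; z≤n; s≤s)
open import Data.Nat.ListAction using (sum)
open import Data.Nat.Properties hiding (_≟_)
open import Algebra.Properties.CommutativeSemigroup +-commutativeSemigroup
  using (interchange)
open import Data.Product.Base using (∃; _,_)
open import Data.Unit.Base using (tt)
open import Function.Base using (id; _∘_)
open import Relation.Nullary using (does; yes; no)
open import Relation.Nullary.Decidable using (dec-true; dec-false)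
open import Relation.Binary.Definitions using (tri<; tri≈; tri>)
open import Relation.Binary.PropositionalEquality

ind : Bool → ℕ
ind true  = 1
ind false = 0

module _ {A : Set} where

  sum-map-+ : ∀ (f g : A → ℕ) xs →
              sum (map (λ x → f x + g x) xs) ≡ sum (map f xs) + sum (map g xs)
  sum-map-+ f g []       = refl
  sum-map-+ f g (x ∷ xs) =
    trans (cong (f x + g x +_) (sum-map-+ f g xs)) (interchange (f x) (g x) _ _)

  sum-map-*ˡ : ∀ k (f : A → ℕ) xs → sum (map (λ x → k * f x) xs) ≡ k * sum (map f xs)
  sum-map-*ˡ k f []       = sym (*-zeroʳ k)
  sum-map-*ˡ k f (x ∷ xs) =
    trans (cong (k * f x +_) (sum-map-*ˡ k f xs)) (sym (*-distribˡ-+ k (f x) _))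

  sum-map-mono : ∀ {f g : A → ℕ} xs → (∀ x → f x ≤ g x) → sum (map f xs) ≤ sum (map g xs)
  sum-map-mono []       f≤g = z≤n
  sum-map-mono (x ∷ xs) f≤g = +-mono-≤ (f≤g x) (sum-map-mono xs f≤g)

  countL≡sum : ∀ (p : A → Bool) xs → countL p xs ≡ sum (map (ind ∘ p) xs)
  countL≡sum p []       = refl
  countL≡sum p (x ∷ xs) with p x
  ... | true  = cong suc (countL≡sum p xs)
  ... | false = countL≡sum p xs

  countL-false : ∀ xs → countL {A} (λ _ → false) xs ≡ 0
  countL-false []       = refl
  countL-false (x ∷ xs) = countL-false xs

  countL+countL : ∀ (p q : A → Bool) xs →
                  countL p xs + countL q xs ≡ sum (map (λ x → ind (p x) + ind (q x)) xs)
  countL+countL p q xs = begin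
    countL p xs + countL q xs                     ≡⟨ cong₂ _+_ (countL≡sum p xs) (countL≡sum q xs) ⟩
    sum (map (ind ∘ p) xs) + sum (map (ind ∘ q) xs) ≡⟨ sum-map-+ (ind ∘ p) (ind ∘ q) xs ⟨
    sum (map (λ x → ind (p x) + ind (q x)) xs)     ∎
    where open ≡-Reasoning

  countL-cong : ∀ {p q : A → Bool} xs → (∀ x → p x ≡ q x) → countL p xs ≡ countL q xs
  countL-cong {p} {q} xs p≡q = begin
    countL p xs            ≡⟨ countL≡sum p xs ⟩
    sum (map (ind ∘ p) xs) ≡⟨ cong sum (map-cong (cong ind ∘ p≡q) xs) ⟩
    sum (map (ind ∘ q) xs) ≡⟨ countL≡sum q xs ⟨
    countL q xs            ∎
    where open ≡-Reasoning

  module _ {p q r : A → Bool} (xs : List A) where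

    countL-split : (∀ x → ind (p x) ≡ ind (q x) + ind (r x)) →
                   countL p xs ≡ countL q xs + countL r xs
    countL-split split = begin
      countL p xs                                ≡⟨ countL≡sum p xs ⟩
      sum (map (ind ∘ p) xs)                     ≡⟨ cong sum (map-cong split xs) ⟩
      sum (map (λ x → ind (q x) + ind (r x)) xs) ≡⟨ countL+countL q r xs ⟨
      countL q xs + countL r xs                  ∎
      where open ≡-Reasoning

    countL-cover : (∀ x → ind (p x) ≤ ind (q x) + ind (r x)) →
                   countL p xs ≤ countL q xs + countL r xs
    countL-cover cover = begin
      countL p xs                                ≡⟨ countL≡sum p xs ⟩
      sum (map (ind ∘ p) xs)                     ≤⟨ sum-map-mono xs cover ⟩
      sum (map (λ x → ind (q x) + ind (r x)) xs) ≡⟨ countL+countL q r xs ⟨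
      countL q xs + countL r xs                  ∎
      where open ≤-Reasoning

    countL-disjoint : (∀ x → ind (p x) + ind (q x) ≤ ind (r x)) →
                      countL p xs + countL q xs ≤ countL r xs
    countL-disjoint disjoint = begin
      countL p xs + countL q xs                  ≡⟨ countL+countL p q xs ⟩
      sum (map (λ x → ind (p x) + ind (q x)) xs) ≤⟨ sum-map-mono xs disjoint ⟩
      sum (map (ind ∘ r) xs)                     ≡⟨ countL≡sum r xs ⟨
      countL r xs                                ∎
      where open ≤-Reasoning

count-suc : ∀ {n} (p : Fin (suc n) → Bool) → count p ≡ ind (p zero) + count (p ∘ suc)
count-suc {n} p = begin
  count p                                             ≡⟨ countL≡sum p (allFin (suc n)) ⟩
  ind (p zero) + sum (map (ind ∘ p) (tabulate suc))   ≡⟨ cong (λ xs → ind (p zero) + sum xs) tabulated ⟩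
  ind (p zero) + sum (map (ind ∘ p ∘ suc) (allFin n)) ≡⟨ cong (ind (p zero) +_) (countL≡sum _ (allFin n)) ⟨
  ind (p zero) + count (p ∘ suc)                      ∎
  where
  open ≡-Reasoning
  tabulated : map (ind ∘ p) (tabulate suc) ≡ map (ind ∘ p ∘ suc) (allFin n)
  tabulated = trans (map-tabulate suc (ind ∘ p)) (sym (map-tabulate id (ind ∘ p ∘ suc)))

count-≟ : ∀ {n} (w : Fin n) → count (λ v → does (v ≟ w)) ≡ 1
count-≟ {suc n} zero    =
  trans (count-suc {n} (λ v → does (v ≟ zero))) (cong suc (countL-false (allFin n)))
count-≟ {suc n} (suc w) = trans (count-suc {n} (λ v → does (v ≟ suc w))) (count-≟ w)

before : ∀ {n} → Ordering n → Fin n → Fin n → Bool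
before τ u v = pos τ u <ᵇ pos τ v

leftDeg rightDeg : ∀ {n} → SimpleGraph n → Ordering n → Fin n → ℕ
leftDeg  G τ v = count (λ u → Adj G u v ∧ before τ u v)
rightDeg G τ v = count (λ u → Adj G u v ∧ before τ v u)

adjacent⇒≢ : ∀ {n} (G : SimpleGraph n) {u v} → Adj G u v ≡ true → u ≢ v
adjacent⇒≢ G {u} adj refl with () ← trans (sym adj) (Adj-irrefl G u)

module _ {n} (τ : Ordering n) where

  pos-injective : ∀ {u v} → pos τ u ≡ pos τ v → u ≡ v
  pos-injective {u} {v} eq =
    trans (sym (inverseˡ τ)) (trans (cong (τ ⟨$⟩ˡ_) (toℕ-injective eq)) (inverseˡ τ))

  before⇒< : ∀ {u v} → before τ u v ≡ true → pos τ u < pos τ v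
  before⇒< {u} {v} u-first = <ᵇ⇒< (pos τ u) (pos τ v) (subst T (sym u-first) tt)

  before-flip : ∀ {u v} → u ≢ v → before τ v u ≡ not (before τ u v)
  before-flip {u} {v} u≢v with <-cmp (pos τ u) (pos τ v)
  ... | tri< u<v _ v≮u = trans (dec-false (pos τ v <? pos τ u) v≮u)
                               (cong not (sym (dec-true (pos τ u <? pos τ v) u<v)))
  ... | tri≈ _ eq _    = ⊥-elim (u≢v (pos-injective eq))
  ... | tri> u≮v _ v<u = trans (dec-true (pos τ v <? pos τ u) v<u)
                               (cong not (sym (dec-false (pos τ u <? pos τ v) u≮v)))

m+n≤∣m-n∣+2*m : ∀ m n → m + n ≤ ∣ m - n ∣ + 2 * m
m+n≤∣m-n∣+2*m m n = begin
  m + n               ≤⟨ +-monoʳ-≤ m (m≤∣m-n∣+n n m) ⟩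
  m + (∣ n - m ∣ + m) ≡⟨ cong (λ d → m + (d + m)) (∣-∣-comm n m) ⟩
  m + (∣ m - n ∣ + m) ≡⟨ +-comm m _ ⟩
  ∣ m - n ∣ + m + m   ≡⟨ +-assoc ∣ m - n ∣ m m ⟩
  ∣ m - n ∣ + (m + m) ≡⟨ cong (λ d → ∣ m - n ∣ + (m + d)) (+-identityʳ m) ⟨
  ∣ m - n ∣ + 2 * m   ∎
  where open ≤-Reasoning

module MoveToFront {n} (σ σ' : Ordering n) (w : Fin n)
  (front : pos σ' w ≡ 0)
  (keeps : ∀ u v → u ≢ w → v ≢ w → pos σ u < pos σ v → pos σ' u < pos σ' v)
  where

  before-preserved : ∀ {u v} → u ≢ w → v ≢ w → before σ' u v ≡ before σ u v
  before-preserved {u} {v} u≢w v≢w with <-cmp (pos σ u) (pos σ v)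
  ... | tri< u<v _ _ = trans (dec-true (pos σ' u <? pos σ' v) (keeps u v u≢w v≢w u<v))
                             (sym (dec-true (pos σ u <? pos σ v) u<v))
  ... | tri≈ _ eq _ with refl ← pos-injective σ eq =
    trans (dec-false (pos σ' u <? pos σ' u) (<-irrefl refl))
          (sym (dec-false (pos σ u <? pos σ u) (<-irrefl refl)))
  ... | tri> _ _ v<u = trans (dec-false (pos σ' u <? pos σ' v) (<-asym (keeps v u v≢w u≢w v<u)))
                             (sym (dec-false (pos σ u <? pos σ v) (<-asym v<u)))

  front-before : ∀ {v} → v ≢ w → before σ' w v ≡ true
  front-before {v} v≢w rewrite front =
    dec-true (0 <? pos σ' v) (n≢0⇒n>0 λ eq → v≢w (pos-injective σ' (trans eq (sym front))))

  nothing-before-front : ∀ v → before σ' v w ≡ false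
  nothing-before-front v rewrite front = refl

  module _ (G : SimpleGraph n) where

    leftDeg-front : leftDeg G σ' w ≡ 0
    leftDeg-front = trans (countL-cong (allFin n) none) (countL-false (allFin n))
      where
      none : ∀ u → (Adj G u w ∧ before σ' u w) ≡ false
      none u = trans (cong (Adj G u w ∧_) (nothing-before-front u)) (∧-zeroʳ _)

    rightDeg-front : rightDeg G σ' w ≡ leftDeg G σ w + rightDeg G σ w
    rightDeg-front = countL-split (allFin n) split
      where
      split : ∀ u → ind (Adj G u w ∧ before σ' w u)
                  ≡ ind (Adj G u w ∧ before σ u w) + ind (Adj G u w ∧ before σ w u)
      split u with Adj G u w in adj
      ... | false = refl
      ... | true rewrite front-before (adjacent⇒≢ G adj) | before-flip σ (adjacent⇒≢ G adj)
        with before σ u w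
      ...   | true  = refl
      ...   | false = refl

    Iv-front : Iv G σ' w ≤ Iv G σ w + 2 * leftDeg G σ w
    Iv-front rewrite leftDeg-front | rightDeg-front = m+n≤∣m-n∣+2*m (leftDeg G σ w) (rightDeg G σ w)

    Iv-unmoved : ∀ {v} → v ≢ w → (Adj G v w ∧ before σ v w) ≡ false → Iv G σ' v ≡ Iv G σ v
    Iv-unmoved {v} v≢w w-first =
      cong₂ ∣_-_∣ (countL-cong (allFin n) left) (countL-cong (allFin n) right)
      where
      v-not-first : Adj G w v ≡ true → before σ v w ≡ false
      v-not-first adj = subst (λ b → b ∧ before σ v w ≡ false) (trans (Adj-sym G v w) adj) w-first

      left : ∀ u → (Adj G u v ∧ before σ' u v) ≡ (Adj G u v ∧ before σ u v)
      left u with u ≟ w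
      ... | no u≢w  = cong (Adj G u v ∧_) (before-preserved u≢w v≢w)
      ... | yes refl with Adj G w v in adj
      ...   | false = refl
      ...   | true  = trans (front-before v≢w)
                        (sym (trans (before-flip σ v≢w) (cong not (v-not-first adj))))

      right : ∀ u → (Adj G u v ∧ before σ' v u) ≡ (Adj G u v ∧ before σ v u)
      right u with u ≟ w
      ... | no u≢w  = cong (Adj G u v ∧_) (before-preserved v≢w u≢w)
      ... | yes refl with Adj G w v in adj
      ...   | false = refl
      ...   | true  = trans (nothing-before-front v) (sym (v-not-first adj))

    module Overtaken {v} (v≢w : v ≢ w) (adj : Adj G v w ≡ true) (v-first : before σ v w ≡ true)
      where

      private
        w-adj : Adj G w v ≡ true
        w-adj = trans (Adj-sym G w v) adj

        w-not-first : before σ w v ≡ false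
        w-not-first = trans (before-flip σ v≢w) (cong not v-first)

      leftDeg-overtaken : leftDeg G σ' v ≡ leftDeg G σ v + 1
      leftDeg-overtaken = trans (countL-split (allFin n) split) (cong (leftDeg G σ v +_) (count-≟ w))
        where
        split : ∀ u → ind (Adj G u v ∧ before σ' u v)
                    ≡ ind (Adj G u v ∧ before σ u v) + ind (does (u ≟ w))
        split u with u ≟ w
        ... | no u≢w   rewrite before-preserved u≢w v≢w = sym (+-identityʳ _)
        ... | yes refl rewrite w-adj | front-before v≢w | w-not-first = refl

      rightDeg-overtaken : rightDeg G σ v ≡ rightDeg G σ' v + 1
      rightDeg-overtaken = trans (countL-split (allFin n) split) (cong (rightDeg G σ' v +_) (count-≟ w))
        where
        split : ∀ u → ind (Adj G u v ∧ before σ v u)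
                    ≡ ind (Adj G u v ∧ before σ' v u) + ind (does (u ≟ w))
        split u with u ≟ w
        ... | no u≢w   rewrite before-preserved v≢w u≢w = sym (+-identityʳ _)
        ... | yes refl rewrite w-adj | nothing-before-front v | v-first = refl

∣m+1-n∣+2≡∣m-n+1∣ : ∀ {m n} → m < n → ∣ m + 1 - n ∣ + 2 ≡ ∣ m - n + 1 ∣
∣m+1-n∣+2≡∣m-n+1∣ {zero}  {suc n} _         = +-suc n 1
∣m+1-n∣+2≡∣m-n+1∣ {suc m} {suc n} (s≤s m<n) = ∣m+1-n∣+2≡∣m-n+1∣ m<n

m+1≤k⇒k+k≤m+n⇒m+1<n : ∀ {m n k} → m + 1 ≤ k → k + k ≤ m + n → m + 1 < n
m+1≤k⇒k+k≤m+n⇒m+1<n {m} {n} {k} m+1≤k k+k≤m+n =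
  +-cancelˡ-≤ m (suc (m + 1)) n (begin
    m + suc (m + 1)     ≡⟨ +-assoc m 1 (m + 1) ⟨
    (m + 1) + (m + 1)   ≤⟨ +-mono-≤ m+1≤k m+1≤k ⟩
    k + k               ≤⟨ k+k≤m+n ⟩
    m + n               ∎)
  where open ≤-Reasoning

⌊n/2⌋+⌊n/2⌋≤n : ∀ n → ⌊ n /2⌋ + ⌊ n /2⌋ ≤ n
⌊n/2⌋+⌊n/2⌋≤n n =
  ≤-trans (+-monoʳ-≤ ⌊ n /2⌋ (⌊n/2⌋≤⌈n/2⌉ n)) (≤-reflexive (⌊n/2⌋+⌈n/2⌉≡n n))

module ShiftL {n} (G : SimpleGraph n) (inY : Fin n → Bool) (bip : IsCompleteBipartite G inY)
  (σ σ' : Ordering n) (w : Fin n)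
  (w∈Y : inY w ≡ true)
  (median : rankY inY σ w ≡ ⌊ count inY /2⌋)
  (front : pos σ' w ≡ 0)
  (keeps : ∀ u v → u ≢ w → v ≢ w → pos σ u < pos σ v → pos σ' u < pos σ' v)
  where

  open MoveToFront σ σ' w front keeps

  neighbour⇒other-side : ∀ {u v} → Adj G u v ≡ true → inY u ≡ not (inY v)
  neighbour⇒other-side {u} {v} adj with inY u | inY v | trans (sym adj) (bip u v)
  ... | true  | false | _ = refl
  ... | false | true  | _ = refl
  ... | true  | true  | ()
  ... | false | false | ()

  Y-adjacent-X : ∀ {u v} → inY u ≡ true → inY v ≡ false → Adj G u v ≡ true
  Y-adjacent-X {u} {v} u∈Y v∈X = trans (bip u v) (cong₂ _xor_ u∈Y v∈X)

  leftDeg+1<rightDeg : ∀ {v} → inY v ≡ false → before σ v w ≡ true →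
                       leftDeg G σ v + 1 < rightDeg G σ v
  leftDeg+1<rightDeg {v} v∈X v-first =
    m+1≤k⇒k+k≤m+n⇒m+1<n left<median (≤-trans (⌊n/2⌋+⌊n/2⌋≤n (count inY)) Y-split)
    where
    v≢w : v ≢ w
    v≢w refl with () ← trans (sym v∈X) w∈Y

    -- Every left neighbour of v lies in Y before w, and so does w itself.
    left<median : leftDeg G σ v + 1 ≤ ⌊ count inY /2⌋
    left<median = begin
      leftDeg G σ v + 1                              ≡⟨ cong (leftDeg G σ v +_) (count-≟ w) ⟨
      leftDeg G σ v + count (λ u → does (u ≟ w))     ≤⟨ countL-disjoint (allFin n) disjoint ⟩
      rankY inY σ w                                  ≡⟨ median ⟩
      ⌊ count inY /2⌋                                ∎
      where
      open ≤-Reasoning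
      disjoint : ∀ u → ind (Adj G u v ∧ before σ u v) + ind (does (u ≟ w))
                       ≤ ind (inY u ∧ (pos σ u ≤ᵇ pos σ w))
      disjoint u with u ≟ w
      ... | yes refl rewrite trans (before-flip σ v≢w) (cong not v-first) | ∧-zeroʳ (Adj G w v)
                           | w∈Y | dec-true (pos σ w ≤? pos σ w) ≤-refl = ≤-refl
      ... | no _ with Adj G u v in adj | before σ u v in u-first
      ...   | false | _     = z≤n
      ...   | true  | false = z≤n
      ...   | true  | true
        rewrite neighbour⇒other-side adj | v∈X
              | dec-true (pos σ u ≤? pos σ w)
                  (<⇒≤ (<-trans (before⇒< σ u-first) (before⇒< σ v-first)))
        = ≤-refl

    Y-split : count inY ≤ leftDeg G σ v + rightDeg G σ v
    Y-split = countL-cover (allFin n) cover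
      where
      cover : ∀ u → ind (inY u) ≤ ind (Adj G u v ∧ before σ u v) + ind (Adj G u v ∧ before σ v u)
      cover u with inY u in u∈Y
      ... | false = z≤n
      ... | true rewrite Y-adjacent-X u∈Y v∈X
                       | before-flip σ (adjacent⇒≢ G (Y-adjacent-X u∈Y v∈X))
        with before σ u v
      ...   | true  = ≤-refl
      ...   | false = ≤-refl

  Iv-overtaken : ∀ {v} → v ≢ w → Adj G v w ≡ true → before σ v w ≡ true →
                 Iv G σ' v + 2 ≡ Iv G σ v
  Iv-overtaken {v} v≢w adj v-first = begin
    ∣ leftDeg G σ' v - j′ ∣ + 2 ≡⟨ cong (λ l → ∣ l - j′ ∣ + 2) leftDeg-overtaken ⟩
    ∣ i + 1 - j′ ∣ + 2          ≡⟨ ∣m+1-n∣+2≡∣m-n+1∣ i<j′ ⟩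
    ∣ i - j′ + 1 ∣              ≡⟨ cong (∣ i -_∣) rightDeg-overtaken ⟨
    ∣ i - rightDeg G σ v ∣      ∎
    where
    open ≡-Reasoning
    open Overtaken G v≢w adj v-first
    i = leftDeg G σ v
    j′ = rightDeg G σ' v
    v∈X : inY v ≡ false
    v∈X = trans (neighbour⇒other-side adj) (cong not w∈Y)
    i<j′ : i < j′
    i<j′ = +-cancelʳ-< 1 i j′ (subst (i + 1 <_) rightDeg-overtaken (leftDeg+1<rightDeg v∈X v-first))

  jumps : ℕ
  jumps = leftDeg G σ w

  -- The jumped neighbours of w each pay 2; w receives the total 2 * jumps.
  paid received : Fin n → ℕ
  paid     v = 2 * ind (Adj G v w ∧ before σ v w)
  received v = 2 * jumps * ind (does (v ≟ w))

  Iv-shiftL : ∀ v → Iv G σ' v + paid v ≤ Iv G σ v + received v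
  Iv-shiftL v with v ≟ w
  ... | yes refl rewrite Adj-irrefl G w | *-identityʳ (2 * jumps) | +-identityʳ (Iv G σ' w) = Iv-front G
  ... | no v≢w rewrite *-zeroʳ (2 * jumps) | +-identityʳ (Iv G σ v)
    with Adj G v w in adj | before σ v w in v-first
  ...   | true  | true  = ≤-reflexive (Iv-overtaken v≢w adj v-first)
  ...   | true  | false = ≤-reflexive (trans (+-identityʳ _) (Iv-unmoved G v≢w (cong₂ _∧_ adj v-first)))
  ...   | false | _     =
    ≤-reflexive (trans (+-identityʳ _) (Iv-unmoved G v≢w (cong (_∧ before σ v w) adj)))

  Iσ-shiftL : Iσ G σ' ≤ Iσ G σ
  Iσ-shiftL = +-cancelʳ-≤ (2 * jumps) _ _ (begin
    Iσ G σ' + 2 * jumps                                ≡⟨ total-paid ⟨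
    sum (map (λ v → Iv G σ' v + paid v) (allFin n))    ≤⟨ sum-map-mono (allFin n) Iv-shiftL ⟩
    sum (map (λ v → Iv G σ v + received v) (allFin n)) ≡⟨ total-received ⟩
    Iσ G σ + 2 * jumps                                 ∎)
    where
    open ≤-Reasoning
    total-paid : sum (map (λ v → Iv G σ' v + paid v) (allFin n)) ≡ Iσ G σ' + 2 * jumps
    total-paid = trans (sum-map-+ (Iv G σ') paid (allFin n)) (cong (Iσ G σ' +_)
      (trans (sum-map-*ˡ 2 _ (allFin n)) (cong (2 *_) (sym (countL≡sum _ (allFin n))))))
    total-received : sum (map (λ v → Iv G σ v + received v) (allFin n)) ≡ Iσ G σ + 2 * jumps
    total-received = trans (sum-map-+ (Iv G σ) received (allFin n)) (cong (Iσ G σ +_)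
      (trans (sum-map-*ˡ (2 * jumps) _ (allFin n))
        (trans (cong (2 * jumps *_) (trans (sym (countL≡sum _ (allFin n))) (count-≟ w)))
          (*-identityʳ (2 * jumps)))))

lemma2 : ∀ {n : ℕ} (G : SimpleGraph n) (inY : Fin n → Bool)
    → IsCompleteBipartite G inY
    → ∃ (λ x → inY x ≡ false)
    → (σ σ' : Ordering n) → ImbalanceOptimal G σ
    → (w : Fin n) → IsShiftL inY σ σ' w
    → Iσ G σ ≡ Iσ G σ'
lemma2 G inY bip _ σ σ' optimal w (w∈Y , median , front , keeps) =
  ≤-antisym (optimal σ') (ShiftL.Iσ-shiftL G inY bip σ σ' w w∈Y median front keeps)
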